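{- Let $w$ be an $\mathbf{ab}$-polynomial that is homogeneous of degree greater than zero. Then $$\varphi_{ub}(\mathbf a\cdot w)=\omega(\mathbf a\cdot r(w))\cdot(\mathbf a-\mathbf b).$$
   Context: All maps are linear on $\mathbb{Z}\langle\mathbf a,\mathbf b\rangle$ (noncommutative polynomials) and defined on monomials. Coproduct: for a monomial $u=u_1\cdots u_N$ and $k\ge1$, $\Delta^{k-1}(u)=\sum_{1\le i_1<\dots<i_{k-1}\le N}u_{(1)}\otimes\cdots\otimes u_{(k)}$, where the $u_{(j)}$ are the consecutive segments obtained by deleting the letters at positions $i_1,\dots,i_{k-1}$; written $\sum_u$. $\kappa(v)=(\mathbf a-\mathbf b)^m$ if $v=\mathbf a^m$, else $0$; $\beta(v)=(\mathbf a-\mathbf b)^m$ if $v=\mathbf b^m$, else $0$; $\eta(v)=2(\mathbf a-\mathbf b)^{m+k}$ if $v=\mathbf b^m\mathbf a^k$, else $0$ ($m,k\ge0$); $\lambda_{ub}=\eta-2\beta$. $\varphi_{ub,1}=\kappa$, $\varphi_{ub,k}(v)=\sum_v\kappa(v_{(1)})\,\mathbf b\,\eta(v_{(2)})\,\mathbf b\cdots\mathbf b\,\eta(v_{(k-1)})\,\mathbf b\,\lambda_{ub}(v_{(k)})$ for $k\ge2$, $\varphi_{ub}=\sum_{k\ge1}\varphi_{ub,k}$. $r$ is the linear map with $r(1)=0$, $r(v\mathbf a)=v$, $r(v\mathbf b)=0$. With $\mathbf c=\mathbf a+\mathbf b$ and $\mathbf d=\mathbf{ab}+\mathbf{ba}$,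 $\omega$ is the linear map that replaces each occurrence of $\mathbf{ab}$ in a monomial by $2\mathbf d$ and then each remaining letter by $\mathbf c$. -}

module Defs where

open import Data.Nat using (ℕ; zero; suc)
open import Data.Integer using (ℤ; _+_; _*_; -_; 0ℤ; 1ℤ)
open import Data.Product using (_×_; _,_)
open import Data.List using (List; []; _∷_; _++_; map; concatMap; length; [_])
open import Data.Bool using (Bool; true; false; if_then_else_; _∧_)
open import Relation.Nullary using (Dec; yes; no)
open import Relation.Binary.PropositionalEquality using (_≡_; _≢_; refl)

data Letter : Set where
  𝐚 𝐛 : Letter

_≟L_ : (x y : Letter) → Dec (x ≡ y)
𝐚 ≟L 𝐚 = yes refl
𝐚 ≟L 𝐛 = no λ ()
𝐛 ≟L 𝐚 = no λ ()
𝐛 ≟L 𝐛 = yes refl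

Word : Set
Word = List Letter

_≟W_ : (u v : Word) → Dec (u ≡ v)
[] ≟W [] = yes refl
[] ≟W (_ ∷ _) = no λ ()
(_ ∷ _) ≟W [] = no λ ()
(x ∷ u) ≟W (y ∷ v) with x ≟L y | u ≟W v
... | yes refl | yes refl = yes refl
... | no ¬p | _ = no λ { refl → ¬p refl }
... | yes _ | no ¬q = no λ { refl → ¬q refl }

-- Noncommutative polynomials in Z<a,b>: formal finite Z-linear combinations
-- of words; two representations denote the same polynomial iff all
-- coefficients agree (_≈_ below).
Poly : Set
Poly = List (ℤ × Word)

coeff : Poly → Word → ℤ
coeff [] m = 0ℤ
coeff ((c , u) ∷ p) m with u ≟W m
... | yes _ = c + coeff p m
... | no _ = coeff p m

infix 4 _≈_
_≈_ : Poly → Poly → Set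
p ≈ q = ∀ m → coeff p m ≡ coeff q m

Homogeneous : ℕ → Poly → Set
Homogeneous n p = ∀ m → coeff p m ≢ 0ℤ → length m ≡ n

0P : Poly
0P = []

1P : Poly
1P = [ (1ℤ , []) ]

mono : Word → Poly
mono u = [ (1ℤ , u) ]

infixl 6 _+P_ _-P_
infixl 7 _*P_ _·_

_+P_ : Poly → Poly → Poly
p +P q = p ++ q

_·_ : ℤ → Poly → Poly
c · p = map (λ { (d , u) → (c * d , u) }) p

_-P_ : Poly → Poly → Poly
p -P q = p +P (- 1ℤ) · q

_*P_ : Poly → Poly → Poly
p *P q = concatMap (λ { (c , u) → map (λ { (d , v) → (c * d , u ++ v) }) q }) p

_^P_ : Poly → ℕ → Poly
p ^P zero = 1P
p ^P suc n = p *P (p ^P n)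

aP bP : Poly
aP = mono [ 𝐚 ]
bP = mono [ 𝐛 ]

a-b : Poly
a-b = aP -P bP

lin : (Word → Poly) → Poly → Poly
lin f p = concatMap (λ { (c , u) → c · f u }) p

sumP : List Poly → Poly
sumP [] = 0P
sumP (p ∷ ps) = p +P sumP ps

allA : Word → Bool
allA [] = true
allA (𝐚 ∷ u) = allA u
allA (𝐛 ∷ u) = false

allB : Word → Bool
allB [] = true
allB (𝐛 ∷ u) = allB u
allB (𝐚 ∷ u) = false

isBA : Word → Bool
isBA [] = true
isBA (𝐛 ∷ u) = isBA u
isBA (𝐚 ∷ u) = allA u

κ : Word → Poly
κ v = if allA v then a-b ^P length v else 0P

β : Word → Poly
β v = if allB v then a-b ^P length v else 0P

η : Word → Poly
η v = if isBA v then (+ 2) · (a-b ^P length v) else 0P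
  where open import Data.Integer using (+_)

λub : Word → Poly
λub v = η v -P (+ 2) · β v
  where open import Data.Integer using (+_)

-- iterated coproduct: splits k u lists all k-tuples (u(1),...,u(k)) of
-- consecutive segments obtained by deleting k-1 letters of u at positions
-- i1 < ... < i(k-1).
cuts : Word → List (Word × Word)
cuts [] = []
cuts (l ∷ u) = ([] , u) ∷ map (λ { (x , y) → (l ∷ x , y) }) (cuts u)

extendWith : (Word → List (List Word)) → List (Word × Word) → List (List Word)
extendWith f [] = []
extendWith f ((x , y) ∷ cs) = map (x ∷_) (f y) ++ extendWith f cs

splits : ℕ → Word → List (List Word)
splits zero u = []
splits (suc zero) u = [ [ u ] ]
splits (suc (suc k)) u = extendWith (splits (suc k)) (cuts u)

tailTerm : List Word → Poly
tailTerm [] = 0P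
tailTerm (v ∷ []) = λub v
tailTerm (v ∷ vs@(_ ∷ _)) = η v *P bP *P tailTerm vs

term : List Word → Poly
term [] = 0P
term (v ∷ []) = κ v
term (v ∷ vs@(_ ∷ _)) = κ v *P bP *P tailTerm vs

φk : ℕ → Word → Poly
φk k v = sumP (map term (splits k v))

-- φub = Σ_{k≥1} φub,k ; on a word v only k ≤ length v + 1 contribute
-- (Δ^{k-1}(v) is the empty sum for k-1 > length v).
φsum : ℕ → Word → Poly
φsum zero v = 0P
φsum (suc k) v = φk (suc k) v +P φsum k v

φubW : Word → Poly
φubW v = φsum (suc (length v)) v

φub : Poly → Poly
φub = lin φubW

rW : Word → Poly
rW [] = 0P
rW (x ∷ []) with x
... | 𝐚 = 1P
... | 𝐛 = 0P
rW (x ∷ u@(_ ∷ _)) = mono [ x ] *P rW u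

r : Poly → Poly
r = lin rW

cP dP : Poly
cP = aP +P bP
dP = aP *P bP +P bP *P aP

ωW : Word → Poly
ωW [] = 1P
ωW (𝐚 ∷ 𝐛 ∷ u) = ((+ 2) · dP) *P ωW u
  where open import Data.Integer using (+_)
ωW (𝐚 ∷ []) = cP
ωW (𝐚 ∷ 𝐚 ∷ u) = cP *P ωW (𝐚 ∷ u)
ωW (𝐛 ∷ u) = cP *P ωW u

ω : Poly → Poly
ω = lin ωW

module Submission where

-- Write φ and τ for the partial sums φsum, τsum of φub and of its variant in
-- which the first factor κ is replaced by η. Cutting a word at its first
-- deleted letter gives φ(v) = κ(v) + Σ κ(x) b τ(y) and τ(v) = λub(v) + Σ η(x) b τ(y),
-- summed over v = x l y. Reading off the first letter then yields
--   φ(a u) = (a−b) φ(u) + b τ(u),   φ(b u) = b τ(u),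
--   τ(a u) = 2 φ(a u),              τ(b u) = (a−b) τ(u) + 2 b τ(u).
-- Since (a−b) + 2b = c and (a−b) b + b c = d, induction on the word gives
-- τ(y) = 2 ω(r y)(a−b) and φ(a w) = ω(a r w)(a−b) for w ≠ 1; these match ω
-- reading a word letter by letter. Positive degree excludes w = 1, where
-- φ(a) = a−b but ω(a r 1) = 0.

open import Defs
open import Data.Nat using (ℕ; _>_; zero; suc; s≤s; z≤n; _≤_)
open import Data.Nat.Properties using (≤-refl; ≤-trans; m≤n⇒m≤1+n; <⇒≤)
open import Data.Integer as ℤ using (ℤ; _+_; _*_; -_; 0ℤ; 1ℤ; _≟_)
open import Data.Integer.Properties
  using (+-identityˡ; +-identityʳ; +-assoc; +-comm; *-identityˡ; *-identityʳ; *-zeroˡ; *-zeroʳ; *-distribˡ-+)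
open import Data.Integer.Tactic.RingSolver using (solve-∀)
open import Data.Product using (_×_; _,_; proj₁; proj₂)
open import Data.List using (List; []; _∷_; _++_; map; length)
open import Data.List.Properties using (++-assoc; ++-identityʳ; map-++; map-∘)
open import Data.List.Relation.Unary.All as All using (All; []; _∷_)
open import Data.Bool using (true; false)
open import Data.Empty using (⊥-elim)
open import Relation.Nullary using (yes; no)
open import Relation.Binary.PropositionalEquality
  using (_≡_; _≢_; refl; sym; trans; cong; cong₂; module ≡-Reasoning)
open import Relation.Binary.Bundles using (Setoid)
open import Algebra.Bundles using (CommutativeMonoid)
import Algebra.Properties.CommutativeSemigroup as CommutativeSemigroupProperties

-- Coefficients are pairings with Kronecker deltas (coeff≡pair-δ), so once pairing
-- is shown to respect ≈ (pair-resp-≈), every ring law reduces to a law of pairing.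
pair : (Word → ℤ) → Poly → ℤ
pair G [] = 0ℤ
pair G ((c , u) ∷ p) = c * G u + pair G p

pair-++ : ∀ G p q → pair G (p ++ q) ≡ pair G p + pair G q
pair-++ G [] q = sym (+-identityˡ _)
pair-++ G ((c , u) ∷ p) q = trans (cong (c * G u +_) (pair-++ G p q)) (sym (+-assoc (c * G u) _ _))

factor-+ : ∀ c d g s → c * d * g + c * s ≡ c * (d * g + s)
factor-+ = solve-∀

pair-· : ∀ G c p → pair G (c · p) ≡ c * pair G p
pair-· G c [] = sym (*-zeroʳ c)
pair-· G c ((d , u) ∷ p) = trans (cong (c * d * G u +_) (pair-· G c p)) (factor-+ c d (G u) (pair G p))

pair-congˡ : ∀ {G H} p → (∀ u → G u ≡ H u) → pair G p ≡ pair H p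
pair-congˡ [] e = refl
pair-congˡ ((c , u) ∷ p) e = cong₂ (λ x y → c * x + y) (e u) (pair-congˡ p e)

pair-+ : ∀ G H p → pair (λ u → G u + H u) p ≡ pair G p + pair H p
pair-+ G H [] = refl
pair-+ G H ((c , u) ∷ p) = trans (cong (c * (G u + H u) +_) (pair-+ G H p)) (regroup c (G u) (H u) (pair G p) (pair H p))
  where
  regroup : ∀ c g h s t → c * (g + h) + (s + t) ≡ (c * g + s) + (c * h + t)
  regroup = solve-∀

pair-* : ∀ k G p → pair (λ u → k * G u) p ≡ k * pair G p
pair-* k G [] = sym (*-zeroʳ k)
pair-* k G ((c , u) ∷ p) = trans (cong (c * (k * G u) +_) (pair-* k G p)) (regroup c k (G u) (pair G p))
  where
  regroup : ∀ c k g s → c * (k * g) + k * s ≡ k * (c * g + s)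
  regroup = solve-∀

pair-zero : ∀ p → pair (λ _ → 0ℤ) p ≡ 0ℤ
pair-zero [] = refl
pair-zero ((c , u) ∷ p) = cong₂ _+_ (*-zeroʳ c) (pair-zero p)

pair-mono : ∀ G u → pair G (mono u) ≡ G u
pair-mono G u = trans (+-identityʳ _) (*-identityˡ _)

pair-*P : ∀ H p q → pair H (p *P q) ≡ pair (λ u → pair (λ v → H (u ++ v)) q) p
pair-*P H [] q = refl
pair-*P H ((c , u) ∷ p) q = trans (pair-++ H (map _ q) (p *P q)) (cong₂ _+_ (row q) (pair-*P H p q))
  where
  row : ∀ q → pair H (map (λ { (d , v) → (c * d , u ++ v) }) q) ≡ c * pair (λ v → H (u ++ v)) q
  row [] = sym (*-zeroʳ c)
  row ((d , v) ∷ q) = trans (cong (c * d * H (u ++ v) +_) (row q)) (factor-+ c d (H (u ++ v)) _)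

pair-lin : ∀ H f p → pair H (lin f p) ≡ pair (λ u → pair H (f u)) p
pair-lin H f [] = refl
pair-lin H f ((c , u) ∷ p) = trans (pair-++ H (c · f u) (lin f p)) (cong₂ _+_ (pair-· H c (f u)) (pair-lin H f p))

pair-comm : ∀ (X : Word → Word → ℤ) p q →
  pair (λ u → pair (X u) p) q ≡ pair (λ w → pair (λ u → X u w) q) p
pair-comm X p [] = sym (pair-zero p)
pair-comm X p ((c , u) ∷ q) =
  trans (cong₂ _+_ (sym (pair-* c (X u) p)) (pair-comm X p q))
        (sym (pair-+ (λ w → c * X u w) (λ w → pair (λ u → X u w) q) p))

δ : Word → Word → ℤ
δ m w = coeff (mono w) m

coeff≡pair-δ : ∀ p m → coeff p m ≡ pair (δ m) p
coeff≡pair-δ [] m = refl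
coeff≡pair-δ ((c , u) ∷ p) m with u ≟W m
... | yes _ = cong₂ _+_ (sym (trans (cong (c *_) (+-identityʳ 1ℤ)) (*-identityʳ c))) (coeff≡pair-δ p m)
... | no _ = trans (coeff≡pair-δ p m) (sym (trans (cong (_+ _) (*-zeroʳ c)) (+-identityˡ _)))

coeff-++ : ∀ p q m → coeff (p ++ q) m ≡ coeff p m + coeff q m
coeff-++ p q m = trans (coeff≡pair-δ (p ++ q) m)
  (trans (pair-++ (δ m) p q) (sym (cong₂ _+_ (coeff≡pair-δ p m) (coeff≡pair-δ q m))))

coeff-· : ∀ c p m → coeff (c · p) m ≡ c * coeff p m
coeff-· c p m = trans (coeff≡pair-δ (c · p) m)
  (trans (pair-· (δ m) c p) (sym (cong (c *_) (coeff≡pair-δ p m))))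

≈⇒-P≈0 : ∀ {p q} → p ≈ q → p -P q ≈ 0P
≈⇒-P≈0 {p} {q} p≈q m = begin
  coeff (p -P q) m                ≡⟨ coeff-++ p (- 1ℤ · q) m ⟩
  coeff p m + coeff (- 1ℤ · q) m  ≡⟨ cong₂ _+_ (p≈q m) (coeff-· (- 1ℤ) q m) ⟩
  coeff q m + - 1ℤ * coeff q m    ≡⟨ cancel (coeff q m) ⟩
  0ℤ                              ∎
  where
  open ≡-Reasoning
  cancel : ∀ x → x + - 1ℤ * x ≡ 0ℤ
  cancel = solve-∀

remove : Word → Poly → Poly
remove u [] = []
remove u ((c , v) ∷ p) with v ≟W u
... | yes _ = remove u p
... | no _ = (c , v) ∷ remove u p

remove-head : ∀ u c p → remove u ((c , u) ∷ p) ≡ remove u p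
remove-head u c p with u ≟W u
... | yes _ = refl
... | no u≢u = ⊥-elim (u≢u refl)

length-remove : ∀ u p → length (remove u p) ≤ length p
length-remove u [] = z≤n
length-remove u ((c , v) ∷ p) with v ≟W u
... | yes _ = m≤n⇒m≤1+n (length-remove u p)
... | no _ = s≤s (length-remove u p)

remove-excludes : ∀ u p → All (λ t → proj₂ t ≢ u) (remove u p)
remove-excludes u [] = []
remove-excludes u ((c , v) ∷ p) with v ≟W u
... | yes _ = remove-excludes u p
... | no v≢u = v≢u ∷ remove-excludes u p

pair-remove : ∀ G p u → pair G p ≡ coeff p u * G u + pair G (remove u p)
pair-remove G [] u = sym (cong (_+ 0ℤ) (*-zeroˡ (G u)))
pair-remove G ((c , v) ∷ p) u with v ≟W u
... | yes refl = trans (cong (c * G v +_) (pair-remove G p v)) (collect c (coeff p v) (G v) _)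
  where
  collect : ∀ c k g s → c * g + (k * g + s) ≡ (c + k) * g + s
  collect = solve-∀
... | no _ = trans (cong (c * G v +_) (pair-remove G p u)) (swap c (G v) (coeff p u) (G u) _)
  where
  swap : ∀ c gv k g s → c * gv + (k * g + s) ≡ k * g + (c * gv + s)
  swap = solve-∀

coeff-remove : ∀ u p m → m ≢ u → coeff (remove u p) m ≡ coeff p m
coeff-remove u [] m m≢u = refl
coeff-remove u ((c , v) ∷ p) m m≢u with v ≟W u
... | yes refl with v ≟W m
...   | yes refl = ⊥-elim (m≢u refl)
...   | no _ = coeff-remove u p m m≢u
coeff-remove u ((c , v) ∷ p) m m≢u | no _ with v ≟W m
...   | yes _ = cong (c +_) (coeff-remove u p m m≢u)
...   | no _ = coeff-remove u p m m≢u

coeff-excluded : ∀ u {p} → All (λ t → proj₂ t ≢ u) p → coeff p u ≡ 0ℤ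
coeff-excluded u [] = refl
coeff-excluded u {(c , v) ∷ p} (v≢u ∷ vs) with v ≟W u
... | yes v≡u = ⊥-elim (v≢u v≡u)
... | no _ = coeff-excluded u vs

remove-≈0 : ∀ u p → p ≈ 0P → remove u p ≈ 0P
remove-≈0 u p p≈0 m with m ≟W u
... | yes refl = coeff-excluded m (remove-excludes m p)
... | no m≢u = trans (coeff-remove u p m m≢u) (p≈0 m)

pair-≈0 : ∀ G {n} p → length p ≤ n → p ≈ 0P → pair G p ≡ 0ℤ
pair-≈0 G [] _ _ = refl
pair-≈0 G {suc n} ((c , u) ∷ p) (s≤s l) p≈0 = begin
  pair G ((c , u) ∷ p)                                         ≡⟨ pair-remove G ((c , u) ∷ p) u ⟩
  coeff ((c , u) ∷ p) u * G u + pair G (remove u ((c , u) ∷ p)) ≡⟨ cong₂ _+_ (cong (_* G u) (p≈0 u)) rest≡0 ⟩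
  0ℤ * G u + 0ℤ                                                ≡⟨ cong (_+ 0ℤ) (*-zeroˡ (G u)) ⟩
  0ℤ                                                           ∎
  where
  open ≡-Reasoning
  shorter : length (remove u ((c , u) ∷ p)) ≤ n
  shorter rewrite remove-head u c p = ≤-trans (length-remove u p) l
  rest≡0 : pair G (remove u ((c , u) ∷ p)) ≡ 0ℤ
  rest≡0 = pair-≈0 G (remove u ((c , u) ∷ p)) shorter (remove-≈0 u ((c , u) ∷ p) p≈0)

pair-resp-≈ : ∀ G {p q} → p ≈ q → pair G p ≡ pair G q
pair-resp-≈ G {p} {q} p≈q = difference≡0⇒≡ (begin
  pair G p + - 1ℤ * pair G q    ≡⟨ cong (pair G p +_) (pair-· G (- 1ℤ) q) ⟨
  pair G p + pair G (- 1ℤ · q)  ≡⟨ pair-++ G p (- 1ℤ · q) ⟨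
  pair G (p -P q)               ≡⟨ pair-≈0 G (p -P q) ≤-refl (≈⇒-P≈0 {p} {q} p≈q) ⟩
  0ℤ                            ∎)
  where
  open ≡-Reasoning
  split : ∀ x y → x ≡ (x + - 1ℤ * y) + y
  split = solve-∀
  difference≡0⇒≡ : ∀ {x y} → x + - 1ℤ * y ≡ 0ℤ → x ≡ y
  difference≡0⇒≡ {x} {y} e = trans (split x y) (trans (cong (_+ y) e) (+-identityˡ y))

-- A record wrapper: unlike the Π-type p ≈ q, it lets Agda infer p and q.
infix 4 _≋_
record _≋_ (p q : Poly) : Set where
  constructor ⟨_⟩
  field coeffs : p ≈ q
open _≋_

≋-setoid : Setoid _ _
≋-setoid = record
  { Carrier = Poly
  ; _≈_ = _≋_
  ; isEquivalence = record
    { refl = ⟨ (λ m → refl) ⟩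
    ; sym = λ e → ⟨ (λ m → sym (coeffs e m)) ⟩
    ; trans = λ e f → ⟨ (λ m → trans (coeffs e m) (coeffs f m)) ⟩
    }
  }

open Setoid ≋-setoid using () renaming (refl to ≋-refl; sym to ≋-sym; trans to ≋-trans)

≋-by-pair : ∀ {p q} → (∀ m → pair (δ m) p ≡ pair (δ m) q) → p ≋ q
≋-by-pair {p} {q} e = ⟨ (λ m → trans (coeff≡pair-δ p m) (trans (e m) (sym (coeff≡pair-δ q m)))) ⟩

pair-resp : ∀ G {p q} → p ≋ q → pair G p ≡ pair G q
pair-resp G {p} {q} e = pair-resp-≈ G {p} {q} (coeffs e)

+P-cong : ∀ {p p' q q'} → p ≋ p' → q ≋ q' → p +P q ≋ p' +P q'
+P-cong {p} {p'} {q} {q'} e f = ⟨ (λ m →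
  trans (coeff-++ p q m) (trans (cong₂ _+_ (coeffs e m) (coeffs f m)) (sym (coeff-++ p' q' m)))) ⟩

+P-congˡ : ∀ {p p'} q → p ≋ p' → p +P q ≋ p' +P q
+P-congˡ q e = +P-cong e (≋-refl {q})

+P-congʳ : ∀ p {q q'} → q ≋ q' → p +P q ≋ p +P q'
+P-congʳ p e = +P-cong (≋-refl {p}) e

+P-comm : ∀ p q → p +P q ≋ q +P p
+P-comm p q = ⟨ (λ m →
  trans (coeff-++ p q m) (trans (+-comm (coeff p m) (coeff q m)) (sym (coeff-++ q p m)))) ⟩

+P-assoc : ∀ p q s → (p +P q) +P s ≋ p +P (q +P s)
+P-assoc p q s rewrite ++-assoc p q s = ≋-refl

+P-identityʳ : ∀ p → p +P 0P ≋ p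
+P-identityʳ p rewrite ++-identityʳ p = ≋-refl

·-cong : ∀ c {p q} → p ≋ q → c · p ≋ c · q
·-cong c {p} {q} e = ⟨ (λ m →
  trans (coeff-· c p m) (trans (cong (c *_) (coeffs e m)) (sym (coeff-· c q m)))) ⟩

·-distrib-+P : ∀ c p q → c · (p +P q) ≋ c · p +P c · q
·-distrib-+P c p q = ≋-by-pair λ m → begin
  pair (δ m) (c · (p ++ q))                 ≡⟨ pair-· (δ m) c (p ++ q) ⟩
  c * pair (δ m) (p ++ q)                   ≡⟨ cong (c *_) (pair-++ (δ m) p q) ⟩
  c * (pair (δ m) p + pair (δ m) q)         ≡⟨ *-distribˡ-+ c _ _ ⟩
  c * pair (δ m) p + c * pair (δ m) q       ≡⟨ cong₂ _+_ (pair-· (δ m) c p) (pair-· (δ m) c q) ⟨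
  pair (δ m) (c · p) + pair (δ m) (c · q)   ≡⟨ pair-++ (δ m) (c · p) (c · q) ⟨
  pair (δ m) (c · p +P c · q)               ∎
  where open ≡-Reasoning

*P-congˡ : ∀ {p p'} q → p ≋ p' → p *P q ≋ p' *P q
*P-congˡ {p} {p'} q e = ≋-by-pair λ m →
  trans (pair-*P (δ m) p q) (trans (pair-resp (λ u → pair (λ v → δ m (u ++ v)) q) e) (sym (pair-*P (δ m) p' q)))

*P-congʳ : ∀ p {q q'} → q ≋ q' → p *P q ≋ p *P q'
*P-congʳ p {q} {q'} e = ≋-by-pair λ m →
  trans (pair-*P (δ m) p q) (trans (pair-congˡ p (λ u → pair-resp (λ v → δ m (u ++ v)) e)) (sym (pair-*P (δ m) p q')))

*P-assoc : ∀ p q s → (p *P q) *P s ≋ p *P (q *P s)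
*P-assoc p q s = ≋-by-pair λ m → begin
  pair (δ m) ((p *P q) *P s)
    ≡⟨ trans (pair-*P (δ m) (p *P q) s) (pair-*P _ p q) ⟩
  pair (λ u → pair (λ v → pair (λ t → δ m ((u ++ v) ++ t)) s) q) p
    ≡⟨ pair-congˡ p (λ u → pair-congˡ q (λ v → pair-congˡ s (λ t → cong (δ m) (++-assoc u v t)))) ⟩
  pair (λ u → pair (λ v → pair (λ t → δ m (u ++ (v ++ t))) s) q) p
    ≡⟨ trans (pair-*P (δ m) p (q *P s)) (pair-congˡ p (λ u → pair-*P _ q s)) ⟨
  pair (δ m) (p *P (q *P s))
    ∎
  where open ≡-Reasoning

*P-distribˡ : ∀ p q s → p *P (q +P s) ≋ p *P q +P p *P s
*P-distribˡ p q s = ≋-by-pair λ m → begin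
  pair (δ m) (p *P (q ++ s))
    ≡⟨ pair-*P (δ m) p (q ++ s) ⟩
  pair (λ u → pair (λ v → δ m (u ++ v)) (q ++ s)) p
    ≡⟨ pair-congˡ p (λ u → pair-++ _ q s) ⟩
  pair (λ u → pair (λ v → δ m (u ++ v)) q + pair (λ v → δ m (u ++ v)) s) p
    ≡⟨ pair-+ _ _ p ⟩
  pair (λ u → pair (λ v → δ m (u ++ v)) q) p + pair (λ u → pair (λ v → δ m (u ++ v)) s) p
    ≡⟨ cong₂ _+_ (pair-*P (δ m) p q) (pair-*P (δ m) p s) ⟨
  pair (δ m) (p *P q) + pair (δ m) (p *P s)
    ≡⟨ pair-++ (δ m) (p *P q) (p *P s) ⟨
  pair (δ m) (p *P q +P p *P s)
    ∎
  where open ≡-Reasoning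

*P-distribʳ : ∀ p q s → (p +P q) *P s ≋ p *P s +P q *P s
*P-distribʳ p q s = ≋-by-pair λ m → begin
  pair (δ m) ((p ++ q) *P s)                   ≡⟨ pair-*P (δ m) (p ++ q) s ⟩
  pair (λ u → pair (λ v → δ m (u ++ v)) s) (p ++ q)  ≡⟨ pair-++ _ p q ⟩
  pair (λ u → pair (λ v → δ m (u ++ v)) s) p + pair (λ u → pair (λ v → δ m (u ++ v)) s) q
    ≡⟨ cong₂ _+_ (pair-*P (δ m) p s) (pair-*P (δ m) q s) ⟨
  pair (δ m) (p *P s) + pair (δ m) (q *P s)   ≡⟨ pair-++ (δ m) (p *P s) (q *P s) ⟨
  pair (δ m) (p *P s +P q *P s)                ∎
  where open ≡-Reasoning

·-*P-assoc : ∀ c p q → (c · p) *P q ≋ c · (p *P q)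
·-*P-assoc c p q = ≋-by-pair λ m → begin
  pair (δ m) ((c · p) *P q)                       ≡⟨ pair-*P (δ m) (c · p) q ⟩
  pair (λ u → pair (λ v → δ m (u ++ v)) q) (c · p) ≡⟨ pair-· _ c p ⟩
  c * pair (λ u → pair (λ v → δ m (u ++ v)) q) p   ≡⟨ cong (c *_) (pair-*P (δ m) p q) ⟨
  c * pair (δ m) (p *P q)                          ≡⟨ pair-· (δ m) c (p *P q) ⟨
  pair (δ m) (c · (p *P q))                        ∎
  where open ≡-Reasoning

·-*P-comm : ∀ c p q → p *P (c · q) ≋ c · (p *P q)
·-*P-comm c p q = ≋-by-pair λ m → begin
  pair (δ m) (p *P (c · q))                          ≡⟨ pair-*P (δ m) p (c · q) ⟩
  pair (λ u → pair (λ v → δ m (u ++ v)) (c · q)) p    ≡⟨ pair-congˡ p (λ u → pair-· _ c q) ⟩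
  pair (λ u → c * pair (λ v → δ m (u ++ v)) q) p      ≡⟨ pair-* c _ p ⟩
  c * pair (λ u → pair (λ v → δ m (u ++ v)) q) p      ≡⟨ cong (c *_) (pair-*P (δ m) p q) ⟨
  c * pair (δ m) (p *P q)                             ≡⟨ pair-· (δ m) c (p *P q) ⟨
  pair (δ m) (c · (p *P q))                           ∎
  where open ≡-Reasoning

*P-zeroʳ : ∀ p → p *P 0P ≋ 0P
*P-zeroʳ p = ≋-by-pair λ m → trans (pair-*P (δ m) p []) (pair-zero p)

*P-identityʳ : ∀ p → p *P 1P ≋ p
*P-identityʳ p = ≋-by-pair λ m → trans (pair-*P (δ m) p 1P)
  (pair-congˡ p (λ u → trans (pair-mono (λ v → δ m (u ++ v)) []) (cong (δ m) (++-identityʳ u))))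

*P-identityˡ : ∀ p → 1P *P p ≋ p
*P-identityˡ p = ≋-by-pair λ m → trans (pair-*P (δ m) 1P p) (pair-mono (λ u → pair (λ v → δ m (u ++ v)) p) [])

lin-cong : ∀ f {p q} → p ≋ q → lin f p ≋ lin f q
lin-cong f {p} {q} e = ≋-by-pair λ m →
  trans (pair-lin (δ m) f p) (trans (pair-resp (λ u → pair (δ m) (f u)) e) (sym (pair-lin (δ m) f q)))

lin-mono : ∀ f u → lin f (mono u) ≋ f u
lin-mono f u = ≋-by-pair λ m → trans (pair-lin (δ m) f (mono u)) (pair-mono (λ v → pair (δ m) (f v)) u)

lin-mono-*P : ∀ f u p → lin f (mono u *P p) ≋ lin (λ v → f (u ++ v)) p
lin-mono-*P f u p = ≋-by-pair λ m →
  trans (pair-lin (δ m) f (mono u *P p))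
  (trans (pair-*P (λ v → pair (δ m) (f v)) (mono u) p)
  (trans (pair-mono (λ u' → pair (λ v → pair (δ m) (f (u' ++ v))) p) u) (sym (pair-lin (δ m) (λ v → f (u ++ v)) p))))

lin-*P : ∀ f p q → lin f p *P q ≋ lin (λ v → f v *P q) p
lin-*P f p q = ≋-by-pair λ m →
  trans (pair-*P (δ m) (lin f p) q)
  (trans (pair-lin _ f p)
  (sym (trans (pair-lin (δ m) (λ v → f v *P q) p) (pair-congˡ p (λ w → pair-*P (δ m) (f w) q)))))

*P-lin : ∀ f p q → q *P lin f p ≋ lin (λ v → q *P f v) p
*P-lin f p q = ≋-by-pair λ m →
  trans (pair-*P (δ m) q (lin f p))
  (trans (pair-congˡ q (λ u → pair-lin _ f p))
  (trans (pair-comm (λ u w → pair (λ v → δ m (u ++ v)) (f w)) p q)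
  (sym (trans (pair-lin (δ m) (λ v → q *P f v) p) (pair-congˡ p (λ w → pair-*P (δ m) q (f w)))))))

lin-lin : ∀ f g p → lin f (lin g p) ≋ lin (λ u → lin f (g u)) p
lin-lin f g p = ≋-by-pair λ m →
  trans (pair-lin (δ m) f (lin g p))
  (trans (pair-lin _ g p)
  (sym (trans (pair-lin (δ m) (λ u → lin f (g u)) p) (pair-congˡ p (λ u → pair-lin (δ m) f (g u))))))

pair-congˡ-on : ∀ {G H} p → All (λ t → G (proj₂ t) ≡ H (proj₂ t)) p → pair G p ≡ pair H p
pair-congˡ-on [] [] = refl
pair-congˡ-on ((c , u) ∷ p) (e ∷ es) = cong₂ (λ x y → c * x + y) e (pair-congˡ-on p es)

pair-remove-absent : ∀ G p u → coeff p u ≡ 0ℤ → pair G p ≡ pair G (remove u p)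
pair-remove-absent G p u p[u]≡0 =
  trans (pair-remove G p u) (trans (cong (λ x → x * G u + pair G (remove u p)) p[u]≡0) (+-identityˡ _))

lin-congˡ-except : ∀ {f g} u p → coeff p u ≡ 0ℤ → (∀ v → v ≢ u → f v ≋ g v) → lin f p ≋ lin g p
lin-congˡ-except {f} {g} u p p[u]≡0 f≋g = ≋-by-pair λ m → begin
  pair (δ m) (lin f p)                       ≡⟨ pair-lin (δ m) f p ⟩
  pair (λ v → pair (δ m) (f v)) p            ≡⟨ pair-remove-absent _ p u p[u]≡0 ⟩
  pair (λ v → pair (δ m) (f v)) (remove u p) ≡⟨ pair-congˡ-on (remove u p) (All.map (λ v≢u → pair-resp (δ m) (f≋g _ v≢u)) (remove-excludes u p)) ⟩
  pair (λ v → pair (δ m) (g v)) (remove u p) ≡⟨ pair-remove-absent _ p u p[u]≡0 ⟨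
  pair (λ v → pair (δ m) (g v)) p            ≡⟨ pair-lin (δ m) g p ⟨
  pair (δ m) (lin g p)                       ∎
  where open ≡-Reasoning

open import Relation.Binary.Reasoning.Setoid ≋-setoid

+P-commutativeMonoid : CommutativeMonoid _ _
+P-commutativeMonoid = record
  { Carrier = Poly
  ; _≈_ = _≋_
  ; _∙_ = _+P_
  ; ε = 0P
  ; isCommutativeMonoid = record
    { isMonoid = record
      { isSemigroup = record
        { isMagma = record
          { isEquivalence = Setoid.isEquivalence ≋-setoid
          ; ∙-cong = +P-cong
          }
        ; assoc = +P-assoc
        }
      ; identity = (λ p → ≋-refl) , +P-identityʳ
      }
    ; comm = +P-comm
    }
  }

open CommutativeSemigroupProperties (CommutativeMonoid.commutativeSemigroup +P-commutativeMonoid)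
  using (interchange; x∙yz≈y∙xz; x∙yz≈xz∙y)

sumP-++ : ∀ A B → sumP (A ++ B) ≋ sumP A +P sumP B
sumP-++ [] B = ≋-refl
sumP-++ (p ∷ A) B = ≋-trans (+P-congʳ p (sumP-++ A B)) (≋-sym (+P-assoc p (sumP A) (sumP B)))

module _ {X : Set} where

  sumP-map-cong : ∀ {f g : X → Poly} L → (∀ x → f x ≋ g x) → sumP (map f L) ≋ sumP (map g L)
  sumP-map-cong [] e = ≋-refl
  sumP-map-cong (x ∷ L) e = +P-cong (e x) (sumP-map-cong L e)

  sumP-map-+P : ∀ (f g : X → Poly) L → sumP (map (λ x → f x +P g x) L) ≋ sumP (map f L) +P sumP (map g L)
  sumP-map-+P f g [] = ≋-refl
  sumP-map-+P f g (x ∷ L) = ≋-trans (+P-congʳ (f x +P g x) (sumP-map-+P f g L))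
    (interchange (f x) (g x) (sumP (map f L)) (sumP (map g L)))

  *P-sumP-map : ∀ p (f : X → Poly) L → p *P sumP (map f L) ≋ sumP (map (λ x → p *P f x) L)
  *P-sumP-map p f [] = *P-zeroʳ p
  *P-sumP-map p f (x ∷ L) = ≋-trans (*P-distribˡ p (f x) (sumP (map f L))) (+P-congʳ (p *P f x) (*P-sumP-map p f L))

  ·-sumP-map : ∀ c (f : X → Poly) L → c · sumP (map f L) ≋ sumP (map (λ x → c · f x) L)
  ·-sumP-map c f [] = ≋-refl
  ·-sumP-map c f (x ∷ L) = ≋-trans (·-distrib-+P c (f x) (sumP (map f L))) (+P-congʳ (c · f x) (·-sumP-map c f L))

-- Splitting at the first deleted letter

branch : (Word → Poly) → (Word → Poly) → Word → Poly
branch h t v = sumP (map (λ c → h (proj₁ c) *P bP *P t (proj₂ c)) (cuts v))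

branch-cons : ∀ h t l u → branch h t (l ∷ u) ≡ h [] *P bP *P t u +P branch (λ x → h (l ∷ x)) t u
branch-cons h t l u = cong (λ L → h [] *P bP *P t u +P sumP L) (sym (map-∘ (cuts u)))

branch-congˡ : ∀ {h h'} t v → (∀ x → h x ≋ h' x) → branch h t v ≋ branch h' t v
branch-congˡ {h} {h'} t v e = sumP-map-cong (cuts v) λ c → *P-congˡ (t (proj₂ c)) (*P-congˡ bP (e (proj₁ c)))

branch-+P : ∀ h t t' v → branch h t v +P branch h t' v ≋ branch h (λ y → t y +P t' y) v
branch-+P h t t' v = ≋-trans (≋-sym (sumP-map-+P _ _ (cuts v)))
  (sumP-map-cong (cuts v) λ c → ≋-sym (*P-distribˡ (h (proj₁ c) *P bP) (t (proj₂ c)) (t' (proj₂ c))))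

branch-zero : ∀ h v → branch h (λ _ → 0P) v ≋ 0P
branch-zero h v = ≋-trans (sumP-map-cong (cuts v) λ c → *P-zeroʳ (h (proj₁ c) *P bP)) (zeros (cuts v))
  where
  zeros : ∀ (L : List (Word × Word)) → sumP (map (λ _ → 0P) L) ≋ 0P
  zeros [] = ≋-refl
  zeros (_ ∷ L) = zeros L

*P-branch : ∀ s h t v → s *P branch h t v ≋ branch (λ x → s *P h x) t v
*P-branch s h t v = ≋-trans (*P-sumP-map s _ (cuts v)) (sumP-map-cong (cuts v) λ c → ≋-sym (begin
  s *P h (proj₁ c) *P bP *P t (proj₂ c)   ≈⟨ *P-congˡ (t (proj₂ c)) (*P-assoc s (h (proj₁ c)) bP) ⟩
  s *P (h (proj₁ c) *P bP) *P t (proj₂ c) ≈⟨ *P-assoc s (h (proj₁ c) *P bP) (t (proj₂ c)) ⟩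
  s *P (h (proj₁ c) *P bP *P t (proj₂ c)) ∎))

·-branch : ∀ c h t v → c · branch h t v ≋ branch (λ x → c · h x) t v
·-branch c h t v = ≋-trans (·-sumP-map c _ (cuts v)) (sumP-map-cong (cuts v) λ x → ≋-sym (begin
  (c · h (proj₁ x)) *P bP *P t (proj₂ x)   ≈⟨ *P-congˡ (t (proj₂ x)) (·-*P-assoc c (h (proj₁ x)) bP) ⟩
  c · (h (proj₁ x) *P bP) *P t (proj₂ x)   ≈⟨ ·-*P-assoc c (h (proj₁ x) *P bP) (t (proj₂ x)) ⟩
  c · (h (proj₁ x) *P bP *P t (proj₂ x))   ∎))

data IsCons : List Word → Set where
  cons : ∀ v vs → IsCons (v ∷ vs)

splits-IsCons : ∀ j y → All IsCons (splits (suc j) y)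
splits-IsCons zero y = cons y [] ∷ []
splits-IsCons (suc j) y = extension (cuts y)
  where
  extension : ∀ cs → All IsCons (extendWith (splits (suc j)) cs)
  extension [] = []
  extension ((x , y) ∷ cs) = prefixed (splits (suc j) y)
    where
    prefixed : ∀ L → All IsCons (map (x ∷_) L ++ extendWith (splits (suc j)) cs)
    prefixed [] = extension cs
    prefixed (l ∷ L) = cons x l ∷ prefixed L

tailSum : ℕ → Word → Poly
tailSum j y = sumP (map tailTerm (splits (suc j) y))

-- Summing over the first segment x and the first deleted letter.
sumP-splits-suc : ∀ (f : List Word → Poly) h →
  (∀ x v vs → f (x ∷ v ∷ vs) ≡ h x *P bP *P tailTerm (v ∷ vs)) →
  ∀ j y → sumP (map f (splits (suc (suc j)) y)) ≋ branch h (tailSum j) y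
sumP-splits-suc f h headed j y = extension (cuts y)
  where
  prefix : ∀ x L → All IsCons L → sumP (map f (map (x ∷_) L)) ≋ h x *P bP *P sumP (map tailTerm L)
  prefix x [] [] = ≋-sym (*P-zeroʳ (h x *P bP))
  prefix x ((v ∷ vs) ∷ L) (cons .v .vs ∷ nonEmpty) rewrite headed x v vs =
    ≋-trans (+P-congʳ (h x *P bP *P tailTerm (v ∷ vs)) (prefix x L nonEmpty))
            (≋-sym (*P-distribˡ (h x *P bP) (tailTerm (v ∷ vs)) (sumP (map tailTerm L))))
  extension : ∀ cs → sumP (map f (extendWith (splits (suc j)) cs))
                   ≋ sumP (map (λ c → h (proj₁ c) *P bP *P tailSum j (proj₂ c)) cs)
  extension [] = ≋-refl
  extension ((x , y) ∷ cs) rewrite map-++ f (map (x ∷_) (splits (suc j) y)) (extendWith (splits (suc j)) cs) =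
    ≋-trans (sumP-++ (map f (map (x ∷_) (splits (suc j) y))) _)
            (+P-cong (prefix x (splits (suc j) y) (splits-IsCons j y)) (extension cs))

cumulative : (ℕ → Word → Poly) → ℕ → Word → Poly
cumulative L zero y = 0P
cumulative L (suc k) y = L k y +P cumulative L k y

τsum : ℕ → Word → Poly
τsum = cumulative tailSum

cumulative-suc : ∀ (L : ℕ → Word → Poly) (hd h : Word → Poly) → (∀ y → L 0 y ≋ hd y) → (∀ j y → L (suc j) y ≋ branch h (tailSum j) y) →
  ∀ k y → cumulative L (suc k) y ≋ hd y +P branch h (τsum k) y
cumulative-suc L hd h L0 Lsuc zero y = begin
  L 0 y +P 0P                      ≈⟨ +P-identityʳ (L 0 y) ⟩
  L 0 y                            ≈⟨ L0 y ⟩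
  hd y                             ≈⟨ +P-identityʳ (hd y) ⟨
  hd y +P 0P                       ≈⟨ +P-congʳ (hd y) (branch-zero h y) ⟨
  hd y +P branch h (τsum 0) y      ∎
cumulative-suc L hd h L0 Lsuc (suc k) y = begin
  L (suc k) y +P cumulative L (suc k) y
    ≈⟨ +P-cong (Lsuc k y) (cumulative-suc L hd h L0 Lsuc k y) ⟩
  branch h (tailSum k) y +P (hd y +P branch h (τsum k) y)
    ≈⟨ x∙yz≈y∙xz (branch h (tailSum k) y) (hd y) _ ⟩
  hd y +P (branch h (tailSum k) y +P branch h (τsum k) y)
    ≈⟨ +P-congʳ (hd y) (branch-+P h (tailSum k) (τsum k) y) ⟩
  hd y +P branch h (τsum (suc k)) y
    ∎

φsum≡cumulative : ∀ k v → φsum k v ≡ cumulative (λ j → φk (suc j)) k v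
φsum≡cumulative zero v = refl
φsum≡cumulative (suc k) v = cong (φk (suc k) v +P_) (φsum≡cumulative k v)

φsum-suc : ∀ k v → φsum (suc k) v ≋ κ v +P branch κ (τsum k) v
φsum-suc k v rewrite φsum≡cumulative (suc k) v =
  cumulative-suc (λ j → φk (suc j)) κ κ (λ y → +P-identityʳ (κ y))
    (sumP-splits-suc term κ (λ _ _ _ → refl)) k v

τsum-suc : ∀ k v → τsum (suc k) v ≋ λub v +P branch η (τsum k) v
τsum-suc = cumulative-suc tailSum λub η (λ y → +P-identityʳ (λub y))
  (sumP-splits-suc tailTerm η (λ _ _ _ → refl))

-- Recursions on the first letter

two : ℤ
two = ℤ.+ 2

κ-a : ∀ x → κ (𝐚 ∷ x) ≋ a-b *P κ x
κ-a x with allA x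
... | true = ≋-refl
... | false = ≋-sym (*P-zeroʳ a-b)

η-a : ∀ x → η (𝐚 ∷ x) ≋ two · κ (𝐚 ∷ x)
η-a x with allA x
... | true = ≋-refl
... | false = ≋-refl

η-b : ∀ x → η (𝐛 ∷ x) ≋ a-b *P η x
η-b x with isBA x
... | true = ≋-sym (·-*P-comm two a-b (a-b ^P length x))
... | false = ≋-sym (*P-zeroʳ a-b)

β-b : ∀ x → β (𝐛 ∷ x) ≋ a-b *P β x
β-b x with allB x
... | true = ≋-refl
... | false = ≋-sym (*P-zeroʳ a-b)

λub-a : ∀ u → λub (𝐚 ∷ u) ≋ two · κ (𝐚 ∷ u)
λub-a u = ≋-trans (+P-identityʳ (η (𝐚 ∷ u))) (η-a u)

λub-b : ∀ u → λub (𝐛 ∷ u) ≋ a-b *P λub u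
λub-b u = begin
  η (𝐛 ∷ u) +P - 1ℤ · (two · β (𝐛 ∷ u))    ≈⟨ +P-cong (η-b u) (·-cong (- 1ℤ) (·-cong two (β-b u))) ⟩
  a-b *P η u +P - 1ℤ · (two · (a-b *P β u)) ≈⟨ +P-congʳ (a-b *P η u) (≋-trans (·-*P-comm (- 1ℤ) a-b (two · β u)) (·-cong (- 1ℤ) (·-*P-comm two a-b (β u)))) ⟨
  a-b *P η u +P a-b *P (- 1ℤ · (two · β u)) ≈⟨ *P-distribˡ a-b (η u) (- 1ℤ · (two · β u)) ⟨
  a-b *P λub u                              ∎

λub-[] : λub [] ≋ 0P
λub-[] = ⟨ ≈⇒-P≈0 {two · 1P} {two · 1P} (λ m → refl) ⟩

-- Deleting the first letter l splits off the term with x = []; if hd and h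
-- both pull a factor s out of a leading l, so does the rest.
leading-letter : ∀ (s : Poly) (hd h t : Word → Poly) l u → hd (l ∷ u) ≋ s *P hd u → (∀ x → h (l ∷ x) ≋ s *P h x) →
  hd (l ∷ u) +P branch h t (l ∷ u) ≋ s *P (hd u +P branch h t u) +P h [] *P bP *P t u
leading-letter s hd h t l u hd-l h-l rewrite branch-cons h t l u = begin
  hd (l ∷ u) +P (h [] *P bP *P t u +P branch (λ x → h (l ∷ x)) t u)
    ≈⟨ +P-cong hd-l (+P-congʳ (h [] *P bP *P t u) (≋-trans (branch-congˡ t u h-l) (≋-sym (*P-branch s h t u)))) ⟩
  s *P hd u +P (h [] *P bP *P t u +P s *P branch h t u)
    ≈⟨ x∙yz≈xz∙y (s *P hd u) (h [] *P bP *P t u) (s *P branch h t u) ⟩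
  (s *P hd u +P s *P branch h t u) +P h [] *P bP *P t u
    ≈⟨ +P-congˡ (h [] *P bP *P t u) (*P-distribˡ s (hd u) (branch h t u)) ⟨
  s *P (hd u +P branch h t u) +P h [] *P bP *P t u
    ∎

φsum-[] : ∀ k → φsum (suc k) [] ≋ 1P
φsum-[] k = ≋-trans (φsum-suc k []) (+P-identityʳ 1P)

τsum-[] : ∀ k → τsum (suc k) [] ≋ 0P
τsum-[] k = ≋-trans (τsum-suc k []) (≋-trans (+P-identityʳ (λub [])) λub-[])

φsum-a : ∀ k u → φsum (suc k) (𝐚 ∷ u) ≋ a-b *P φsum (suc k) u +P bP *P τsum k u
φsum-a k u = begin
  φsum (suc k) (𝐚 ∷ u)                                    ≈⟨ φsum-suc k (𝐚 ∷ u) ⟩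
  κ (𝐚 ∷ u) +P branch κ (τsum k) (𝐚 ∷ u)                  ≈⟨ leading-letter a-b κ κ (τsum k) 𝐚 u (κ-a u) κ-a ⟩
  a-b *P (κ u +P branch κ (τsum k) u) +P 1P *P bP *P τsum k u
    ≈⟨ +P-cong (*P-congʳ a-b (φsum-suc k u)) (≋-sym (*P-congˡ (τsum k u) (*P-identityˡ bP))) ⟨
  a-b *P φsum (suc k) u +P bP *P τsum k u                 ∎

φsum-b : ∀ k u → φsum (suc k) (𝐛 ∷ u) ≋ bP *P τsum k u
φsum-b k u = begin
  φsum (suc k) (𝐛 ∷ u)                    ≈⟨ φsum-suc k (𝐛 ∷ u) ⟩
  κ (𝐛 ∷ u) +P branch κ (τsum k) (𝐛 ∷ u)  ≈⟨ leading-letter 0P κ κ (τsum k) 𝐛 u ≋-refl (λ x → ≋-refl) ⟩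
  1P *P bP *P τsum k u                    ≈⟨ *P-congˡ (τsum k u) (*P-identityˡ bP) ⟩
  bP *P τsum k u                          ∎

branch-η-a : ∀ t u → branch η t (𝐚 ∷ u) ≋ two · branch κ t (𝐚 ∷ u)
branch-η-a t u rewrite branch-cons η t 𝐚 u | branch-cons κ t 𝐚 u = begin
  (two · 1P) *P bP *P t u +P branch (λ x → η (𝐚 ∷ x)) t u
    ≈⟨ +P-cong (≋-trans (*P-congˡ (t u) (·-*P-assoc two 1P bP)) (·-*P-assoc two (1P *P bP) (t u)))
               (≋-trans (branch-congˡ t u η-a) (≋-sym (·-branch two (λ x → κ (𝐚 ∷ x)) t u))) ⟩
  two · (1P *P bP *P t u) +P two · branch (λ x → κ (𝐚 ∷ x)) t u
    ≈⟨ ·-distrib-+P two (1P *P bP *P t u) _ ⟨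
  two · (1P *P bP *P t u +P branch (λ x → κ (𝐚 ∷ x)) t u)
    ∎

τsum-a : ∀ k u → τsum (suc k) (𝐚 ∷ u) ≋ two · φsum (suc k) (𝐚 ∷ u)
τsum-a k u = begin
  τsum (suc k) (𝐚 ∷ u)                                  ≈⟨ τsum-suc k (𝐚 ∷ u) ⟩
  λub (𝐚 ∷ u) +P branch η (τsum k) (𝐚 ∷ u)              ≈⟨ +P-cong (λub-a u) (branch-η-a (τsum k) u) ⟩
  two · κ (𝐚 ∷ u) +P two · branch κ (τsum k) (𝐚 ∷ u)    ≈⟨ ·-distrib-+P two (κ (𝐚 ∷ u)) _ ⟨
  two · (κ (𝐚 ∷ u) +P branch κ (τsum k) (𝐚 ∷ u))        ≈⟨ ·-cong two (φsum-suc k (𝐚 ∷ u)) ⟨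
  two · φsum (suc k) (𝐚 ∷ u)                            ∎

τsum-b : ∀ k u → τsum (suc k) (𝐛 ∷ u) ≋ a-b *P τsum (suc k) u +P two · (bP *P τsum k u)
τsum-b k u = begin
  τsum (suc k) (𝐛 ∷ u)                                      ≈⟨ τsum-suc k (𝐛 ∷ u) ⟩
  λub (𝐛 ∷ u) +P branch η (τsum k) (𝐛 ∷ u)                  ≈⟨ leading-letter a-b λub η (τsum k) 𝐛 u (λub-b u) η-b ⟩
  a-b *P (λub u +P branch η (τsum k) u) +P (two · 1P) *P bP *P τsum k u
    ≈⟨ +P-cong (*P-congʳ a-b (τsum-suc k u)) (≋-sym (≋-trans (*P-congˡ (τsum k u) (·-*P-assoc two 1P bP))
                                                       (≋-trans (·-*P-assoc two (1P *P bP) (τsum k u))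
                                                                (·-cong two (*P-congˡ (τsum k u) (*P-identityˡ bP)))))) ⟨
  a-b *P τsum (suc k) u +P two · (bP *P τsum k u)           ∎

-- Closed forms

c≋a-b+2b : cP ≋ a-b +P two · bP
c≋a-b+2b = ≋-by-pair λ m → identity (δ m (𝐚 ∷ [])) (δ m (𝐛 ∷ []))
  where
  identity : ∀ x y → 1ℤ * x + (1ℤ * y + 0ℤ) ≡ 1ℤ * x + (- 1ℤ * y + (two * y + 0ℤ))
  identity = solve-∀

d≋[a-b]b+bc : dP ≋ a-b *P bP +P bP *P cP
d≋[a-b]b+bc = ≋-by-pair λ m → identity (δ m (𝐚 ∷ 𝐛 ∷ [])) (δ m (𝐛 ∷ 𝐚 ∷ [])) (δ m (𝐛 ∷ 𝐛 ∷ []))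
  where
  identity : ∀ x y z → 1ℤ * x + (1ℤ * y + 0ℤ) ≡ 1ℤ * x + (- 1ℤ * z + (1ℤ * y + (1ℤ * z + 0ℤ)))
  identity = solve-∀

*P-c-expand : ∀ p → cP *P p ≋ a-b *P p +P two · (bP *P p)
*P-c-expand p = begin
  cP *P p                          ≈⟨ *P-congˡ p c≋a-b+2b ⟩
  (a-b +P two · bP) *P p           ≈⟨ *P-distribʳ a-b (two · bP) p ⟩
  a-b *P p +P (two · bP) *P p      ≈⟨ +P-congʳ (a-b *P p) (·-*P-assoc two bP p) ⟩
  a-b *P p +P two · (bP *P p)      ∎

*P-d-expand : ∀ p → dP *P p ≋ a-b *P (bP *P p) +P bP *P (cP *P p)
*P-d-expand p = begin
  dP *P p                                  ≈⟨ *P-congˡ p d≋[a-b]b+bc ⟩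
  (a-b *P bP +P bP *P cP) *P p             ≈⟨ *P-distribʳ (a-b *P bP) (bP *P cP) p ⟩
  a-b *P bP *P p +P bP *P cP *P p          ≈⟨ +P-cong (*P-assoc a-b bP p) (*P-assoc bP cP p) ⟩
  a-b *P (bP *P p) +P bP *P (cP *P p)      ∎

ω-1 : ω 1P ≋ 1P
ω-1 = lin-mono ωW []

ω-a : ω aP ≋ cP
ω-a = lin-mono ωW (𝐚 ∷ [])

ω-b*P : ∀ p → ω (bP *P p) ≋ cP *P ω p
ω-b*P p = ≋-trans (lin-mono-*P ωW (𝐛 ∷ []) p) (≋-sym (*P-lin ωW p cP))

ω-a*P : ∀ p → ω (aP *P p) ≋ lin (λ v → ωW (𝐚 ∷ v)) p
ω-a*P p = lin-mono-*P ωW (𝐚 ∷ []) p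

ω-aa*P : ∀ p → ω (aP *P (aP *P p)) ≋ cP *P ω (aP *P p)
ω-aa*P p = begin
  ω (aP *P (aP *P p))                    ≈⟨ ω-a*P (aP *P p) ⟩
  lin (λ v → ωW (𝐚 ∷ v)) (aP *P p)       ≈⟨ lin-mono-*P (λ v → ωW (𝐚 ∷ v)) (𝐚 ∷ []) p ⟩
  lin (λ v → cP *P ωW (𝐚 ∷ v)) p         ≈⟨ *P-lin (λ v → ωW (𝐚 ∷ v)) p cP ⟨
  cP *P lin (λ v → ωW (𝐚 ∷ v)) p         ≈⟨ *P-congʳ cP (ω-a*P p) ⟨
  cP *P ω (aP *P p)                      ∎

ω-ab*P : ∀ p → ω (aP *P (bP *P p)) ≋ (two · dP) *P ω p
ω-ab*P p = begin
  ω (aP *P (bP *P p))                    ≈⟨ ω-a*P (bP *P p) ⟩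
  lin (λ v → ωW (𝐚 ∷ v)) (bP *P p)       ≈⟨ lin-mono-*P (λ v → ωW (𝐚 ∷ v)) (𝐛 ∷ []) p ⟩
  lin (λ v → (two · dP) *P ωW v) p       ≈⟨ *P-lin ωW p (two · dP) ⟨
  (two · dP) *P ω p                      ∎

-- For k > length y, τsum k y and φsum k (a ∷ y) no longer depend on k;
-- these are their stable values.
τ∞ : Word → Poly
τ∞ y = two · (ω (rW y) *P a-b)

φ𝐚∞ : Word → Poly
φ𝐚∞ [] = a-b
φ𝐚∞ w@(_ ∷ _) = ω (aP *P rW w) *P a-b

τ∞-a : ∀ w → τ∞ (𝐚 ∷ w) ≋ two · φ𝐚∞ w
τ∞-a [] = ·-cong two (≋-trans (*P-congˡ a-b ω-1) (*P-identityˡ a-b))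
τ∞-a (_ ∷ _) = ≋-refl

τ∞-b : ∀ y → τ∞ (𝐛 ∷ y) ≋ cP *P τ∞ y
τ∞-b [] = ≋-sym (*P-zeroʳ cP)
τ∞-b y@(_ ∷ _) = begin
  two · (ω (bP *P rW y) *P a-b)     ≈⟨ ·-cong two (*P-congˡ a-b (ω-b*P (rW y))) ⟩
  two · (cP *P ω (rW y) *P a-b)     ≈⟨ ·-cong two (*P-assoc cP (ω (rW y)) a-b) ⟩
  two · (cP *P (ω (rW y) *P a-b))   ≈⟨ ·-*P-comm two cP (ω (rW y) *P a-b) ⟨
  cP *P τ∞ y                        ∎

φ𝐚∞-a : ∀ w → φ𝐚∞ (𝐚 ∷ w) ≋ cP *P φ𝐚∞ w
φ𝐚∞-a [] = *P-congˡ a-b ω-a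
φ𝐚∞-a w@(_ ∷ _) = begin
  ω (aP *P (aP *P rW w)) *P a-b     ≈⟨ *P-congˡ a-b (ω-aa*P (rW w)) ⟩
  cP *P ω (aP *P rW w) *P a-b       ≈⟨ *P-assoc cP (ω (aP *P rW w)) a-b ⟩
  cP *P φ𝐚∞ w                       ∎

φ𝐚∞-b : ∀ w → φ𝐚∞ (𝐛 ∷ w) ≋ dP *P τ∞ w
φ𝐚∞-b [] = ≋-sym (*P-zeroʳ dP)
φ𝐚∞-b w@(_ ∷ _) = begin
  ω (aP *P (bP *P rW w)) *P a-b     ≈⟨ *P-congˡ a-b (ω-ab*P (rW w)) ⟩
  (two · dP) *P ω (rW w) *P a-b     ≈⟨ *P-assoc (two · dP) (ω (rW w)) a-b ⟩
  (two · dP) *P (ω (rW w) *P a-b)   ≈⟨ ·-*P-assoc two dP (ω (rW w) *P a-b) ⟩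
  two · (dP *P (ω (rW w) *P a-b))   ≈⟨ ·-*P-comm two dP (ω (rW w) *P a-b) ⟨
  dP *P τ∞ w                        ∎

mutual
  τsum-stable : ∀ y {k} → length y ≤ k → τsum (suc k) y ≋ τ∞ y
  τsum-stable [] {k} _ = τsum-[] k
  τsum-stable (𝐚 ∷ w) {k} len≤k = begin
    τsum (suc k) (𝐚 ∷ w)         ≈⟨ τsum-a k w ⟩
    two · φsum (suc k) (𝐚 ∷ w)   ≈⟨ ·-cong two (φsum-𝐚-stable w len≤k) ⟩
    two · φ𝐚∞ w                  ≈⟨ τ∞-a w ⟨
    τ∞ (𝐚 ∷ w)                   ∎
  τsum-stable (𝐛 ∷ u) {suc k} (s≤s len≤k) = begin
    τsum (suc (suc k)) (𝐛 ∷ u)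
      ≈⟨ τsum-b (suc k) u ⟩
    a-b *P τsum (suc (suc k)) u +P two · (bP *P τsum (suc k) u)
      ≈⟨ +P-cong (*P-congʳ a-b (τsum-stable u (m≤n⇒m≤1+n len≤k)))
                 (·-cong two (*P-congʳ bP (τsum-stable u len≤k))) ⟩
    a-b *P τ∞ u +P two · (bP *P τ∞ u)
      ≈⟨ *P-c-expand (τ∞ u) ⟨
    cP *P τ∞ u
      ≈⟨ τ∞-b u ⟨
    τ∞ (𝐛 ∷ u)
      ∎

  φsum-𝐚-stable : ∀ w {k} → length (𝐚 ∷ w) ≤ k → φsum (suc k) (𝐚 ∷ w) ≋ φ𝐚∞ w
  φsum-𝐚-stable [] {suc k} _ = begin
    φsum (suc (suc k)) (𝐚 ∷ [])                             ≈⟨ φsum-a (suc k) [] ⟩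
    a-b *P φsum (suc (suc k)) [] +P bP *P τsum (suc k) []   ≈⟨ +P-cong (*P-congʳ a-b (φsum-[] (suc k))) (*P-congʳ bP (τsum-[] k)) ⟩
    a-b *P 1P +P bP *P 0P                                   ≈⟨ +P-cong (*P-identityʳ a-b) (*P-zeroʳ bP) ⟩
    a-b +P 0P                                               ≈⟨ +P-identityʳ a-b ⟩
    a-b                                                     ∎
  φsum-𝐚-stable (𝐚 ∷ w) {suc k} (s≤s len≤k) = begin
    φsum (suc (suc k)) (𝐚 ∷ 𝐚 ∷ w)
      ≈⟨ φsum-a (suc k) (𝐚 ∷ w) ⟩
    a-b *P φsum (suc (suc k)) (𝐚 ∷ w) +P bP *P τsum (suc k) (𝐚 ∷ w)
      ≈⟨ +P-cong (*P-congʳ a-b (φsum-𝐚-stable w (m≤n⇒m≤1+n len≤k)))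
                 (*P-congʳ bP (≋-trans (τsum-stable (𝐚 ∷ w) len≤k) (τ∞-a w))) ⟩
    a-b *P φ𝐚∞ w +P bP *P (two · φ𝐚∞ w)
      ≈⟨ +P-congʳ (a-b *P φ𝐚∞ w) (·-*P-comm two bP (φ𝐚∞ w)) ⟩
    a-b *P φ𝐚∞ w +P two · (bP *P φ𝐚∞ w)
      ≈⟨ *P-c-expand (φ𝐚∞ w) ⟨
    cP *P φ𝐚∞ w
      ≈⟨ φ𝐚∞-a w ⟨
    φ𝐚∞ (𝐚 ∷ w)
      ∎
  φsum-𝐚-stable (𝐛 ∷ w) {suc k} (s≤s len≤k) = begin
    φsum (suc (suc k)) (𝐚 ∷ 𝐛 ∷ w)
      ≈⟨ φsum-a (suc k) (𝐛 ∷ w) ⟩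
    a-b *P φsum (suc (suc k)) (𝐛 ∷ w) +P bP *P τsum (suc k) (𝐛 ∷ w)
      ≈⟨ +P-cong (*P-congʳ a-b (≋-trans (φsum-b (suc k) w) (*P-congʳ bP (τsum-stable w (<⇒≤ len≤k)))))
                 (*P-congʳ bP (≋-trans (τsum-stable (𝐛 ∷ w) len≤k) (τ∞-b w))) ⟩
    a-b *P (bP *P τ∞ w) +P bP *P (cP *P τ∞ w)
      ≈⟨ *P-d-expand (τ∞ w) ⟨
    dP *P τ∞ w
      ≈⟨ φ𝐚∞-b w ⟨
    φ𝐚∞ (𝐛 ∷ w)
      ∎

homogeneous⇒coeff-[]≡0 : ∀ n → n > 0 → ∀ w → Homogeneous n w → coeff w [] ≡ 0ℤ
homogeneous⇒coeff-[]≡0 n n>0 w hom with coeff w [] ≟ 0ℤ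
... | yes w[[]]≡0 = w[[]]≡0
... | no w[[]]≢0 with hom [] w[[]]≢0
... | refl with () ← n>0

φubW-𝐚 : ∀ v → v ≢ [] → φubW (𝐚 ∷ v) ≋ ω (aP *P rW v) *P a-b
φubW-𝐚 [] []≢[] = ⊥-elim ([]≢[] refl)
φubW-𝐚 v@(_ ∷ _) _ = φsum-𝐚-stable v ≤-refl

proposition4p9 : (n : ℕ) → n > 0 → (w : Poly) → Homogeneous n w →
    φub (aP *P w) ≈ ω (aP *P r w) *P a-b
proposition4p9 n n>0 w hom = coeffs (begin
  φub (aP *P w)                          ≈⟨ lin-mono-*P φubW (𝐚 ∷ []) w ⟩
  lin (λ v → φubW (𝐚 ∷ v)) w             ≈⟨ lin-congˡ-except [] w (homogeneous⇒coeff-[]≡0 n n>0 w hom) φubW-𝐚 ⟩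
  lin (λ v → ω (aP *P rW v) *P a-b) w    ≈⟨ lin-*P (λ v → ω (aP *P rW v)) w a-b ⟨
  lin (λ v → ω (aP *P rW v)) w *P a-b    ≈⟨ *P-congˡ a-b (lin-lin ωW (λ v → aP *P rW v) w) ⟨
  ω (lin (λ v → aP *P rW v) w) *P a-b    ≈⟨ *P-congˡ a-b (lin-cong ωW (*P-lin rW w aP)) ⟨
  ω (aP *P r w) *P a-b                   ∎)
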